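{- Let $m<n$ be positive integers with $m+n$ odd, let $k\ge1$, and fix $t=t_1\cdots t_k\in\{m,n\}^k$. Let $D_k$ be as defined in the context. Then for every infinite sequence $y$ with values in $\{m,n\}$, the first $D_k$ terms of the infinite sequence $E(y,t)$ are the same; i.e. they do not depend on $y$.
   Context: For $x\in\{m,n\}$ write $\bar x=m+n-x$. For a finite or infinite sequence $s$ of positive integers and $x\in\{m,n\}$, $E(s,x)$ is the concatenation $x^{s_1}\bar x^{s_2}x^{s_3}\cdots$ (runs of lengths $s_1,s_2,\dots$, values alternating, starting with $x$). For $t=t_1\cdots t_k\in\{m,n\}^k$ with $k\ge2$, $E(s,t)=E(E(s,t_1),t_2\cdots t_k)$. Definition of $D_k$ (for $m<n$): choose $t^{(1)},\dots,t^{(k)}\in\{m,n\}$; let $s^{(0)}$ be the empty sequence and for $0\le j<k$ let $s^{(j+1)}=E(s^{(j)}m,\,t^{(j+1)})$, where $s^{(j)}m$ denotes $s^{(j)}$ with the term $m$ appended. Then $D_k$ is the minimum of $|s^{(k)}|$ over all $2^k$ choices of $(t^{(1)},\dots,t^{(k)})$. -}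

module Defs where

open import Data.Nat using (ℕ; zero; suc; _+_; _∸_; _⊓_; _<ᵇ_)
open import Data.Bool using (Bool; true; false; if_then_else_)
open import Data.List using (List; []; _∷_; _++_; replicate; length; map; concatMap; [_])
open import Data.Vec using (Vec; []; _∷_)

bar : ℕ → ℕ → ℕ → ℕ
bar m n x = (m + n) ∸ x

Efin : ℕ → ℕ → List ℕ → ℕ → List ℕ
Efin m n []      x = []
Efin m n (a ∷ s) x = replicate a x ++ Efin m n s (bar m n x)

EfinW : ℕ → ℕ → List ℕ → List ℕ → List ℕ
EfinW m n s []      = s
EfinW m n s (x ∷ t) = EfinW m n (Efin m n s x) t

-- s^{(k)} for a choice (t^{(1)},…,t^{(k)}), given as the list of the t^{(j)}:
-- s^{(0)} = [],  s^{(j+1)} = E(s^{(j)} m, t^{(j+1)})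
sChain : ℕ → ℕ → List ℕ → List ℕ → List ℕ
sChain m n s []      = s
sChain m n s (x ∷ c) = sChain m n (Efin m n (s ++ [ m ]) x) c

choices : ℕ → ℕ → ℕ → List (List ℕ)
choices m n zero    = [] ∷ []
choices m n (suc k) = concatMap (λ c → (m ∷ c) ∷ (n ∷ c) ∷ []) (choices m n k)

-- minimum of a list (the list below is always nonempty)
minList : List ℕ → ℕ
minList []       = 0
minList (a ∷ []) = a
minList (a ∷ b ∷ l) = a ⊓ minList (b ∷ l)

D : ℕ → ℕ → ℕ → ℕ
D m n k = minList (map (λ c → length (sChain m n [] c)) (choices m n k))

-- Infinite sequences are functions ℕ → ℕ (index 0 = first term).
-- runIdx y p: index j of the run containing position p in the concatenation
-- of runs of lengths y 0, y 1, …  The fuel p+1 suffices whenever every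
-- y j ≥ 1 (the run index never exceeds the position).
runIdxFuel : ℕ → (ℕ → ℕ) → ℕ → ℕ → ℕ
runIdxFuel zero    y j p = j
runIdxFuel (suc f) y j p = if p <ᵇ y j then j else runIdxFuel f y (suc j) (p ∸ y j)

runIdx : (ℕ → ℕ) → ℕ → ℕ
runIdx y p = runIdxFuel (suc p) y 0 p

isEven : ℕ → Bool
isEven zero          = true
isEven (suc zero)    = false
isEven (suc (suc j)) = isEven j

Einf : ℕ → ℕ → (ℕ → ℕ) → ℕ → (ℕ → ℕ)
Einf m n y x p = if isEven (runIdx y p) then x else bar m n x

EinfW : ∀ {k} → ℕ → ℕ → (ℕ → ℕ) → Vec ℕ k → (ℕ → ℕ)
EinfW m n y []      = y
EinfW m n y (x ∷ t) = EinfW m n (Einf m n y x) t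

module Submission where

open import Defs
open import Data.Nat using (ℕ; zero; suc; _+_; _∸_; _<_; _≤_; _<ᵇ_; z≤n; s≤s; _<?_)
open import Data.Nat.Divisibility using (_∣_)
open import Data.Nat.ListAction using (sum)
open import Data.Nat.Properties
open import Data.Bool using (true; false; if_then_else_)
open import Data.List using (List; []; _∷_; _++_; replicate; length; [_]; concatMap)
open import Data.List.Properties using (length-++; length-replicate)
open import Data.List.Membership.Propositional using (_∈_)
open import Data.List.Relation.Unary.Any using (here; there)
open import Data.List.Membership.Propositional.Properties using (∈-map⁺)
open import Data.Vec using (Vec; toList)
open import Data.Vec.Relation.Unary.All as All using (All)
open import Data.Sum using (_⊎_; inj₁; inj₂)
open import Data.Product using (_×_; _,_)
open import Function using (_∘_)
open import Relation.Nullary using (¬_; yes; no; contradiction)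
open import Relation.Binary.PropositionalEquality
  using (_≡_; refl; sym; trans; cong; cong₂; subst; module ≡-Reasoning)
open ≡-Reasoning

-- If y is bounded below by m and begins with the runs s, then E(y,x) begins with
-- E(s m, x), because the run of y following s has length at least m.  Iterating along t,
-- every E(y,t) begins with s^{(k)} for the choice t itself, whose length is at least D_k.

nth : List ℕ → ℕ → ℕ
nth []       _       = 0
nth (a ∷ as) zero    = a
nth (a ∷ as) (suc i) = nth as i

Prefix : List ℕ → (ℕ → ℕ) → Set
Prefix s y = ∀ p → p < length s → y p ≡ nth s p

nth-++-replicate-< : ∀ a v B q → q < a → nth (replicate a v ++ B) q ≡ v
nth-++-replicate-< (suc a) v B zero    _         = refl
nth-++-replicate-< (suc a) v B (suc q) (s≤s q<a) = nth-++-replicate-< a v B q q<a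

nth-++-replicate-≥ : ∀ a v B q → a ≤ q → nth (replicate a v ++ B) q ≡ nth B (q ∸ a)
nth-++-replicate-≥ zero    v B q       _         = refl
nth-++-replicate-≥ (suc a) v B (suc q) (s≤s a≤q) = nth-++-replicate-≥ a v B q a≤q

runIdxFuel-< : ∀ f y j q → q < y j → runIdxFuel (suc f) y j q ≡ j
runIdxFuel-< f y j q q<yj with q <ᵇ y j | <⇒<ᵇ q<yj
... | true | _ = refl

runIdxFuel-≥ : ∀ f y j q → y j ≤ q →
  runIdxFuel (suc f) y j q ≡ runIdxFuel f y (suc j) (q ∸ y j)
runIdxFuel-≥ f y j q yj≤q with q <ᵇ y j | <ᵇ⇒< q (y j)
... | true  | q<yj = contradiction (q<yj _) (≤⇒≯ yj≤q)
... | false | _    = refl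

runIdxFuel-shift : ∀ f y j q → runIdxFuel f y (suc j) q ≡ suc (runIdxFuel f (y ∘ suc) j q)
runIdxFuel-shift zero    y j q = refl
runIdxFuel-shift (suc f) y j q with q <ᵇ y (suc j)
... | true  = refl
... | false = runIdxFuel-shift f y (suc j) (q ∸ y (suc j))

module _ (m n : ℕ) where

  -- Einf m n y x p unfolds to runValue x (runIdx y p).
  runValue : ℕ → ℕ → ℕ
  runValue x j = if isEven j then x else bar m n x

  bar-involutive : ∀ {x} → x ≤ m + n → bar m n (bar m n x) ≡ x
  bar-involutive = m∸[m∸n]≡n

  bar-≤ : ∀ x → bar m n x ≤ m + n
  bar-≤ x = m∸n≤m (m + n) x

  bar-≥ : ∀ {x} → x ≤ n → m ≤ bar m n x
  bar-≥ {x} x≤n = subst (_≤ bar m n x) (m+n∸n≡m m n) (∸-monoʳ-≤ (m + n) x≤n)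

  runValue-suc : ∀ {x} → x ≤ m + n → ∀ j → runValue x (suc j) ≡ runValue (bar m n x) j
  runValue-suc x≤ zero          = refl
  runValue-suc x≤ (suc zero)    = sym (bar-involutive x≤)
  runValue-suc x≤ (suc (suc j)) = runValue-suc x≤ j

  length-Efin : ∀ s x → length (Efin m n s x) ≡ sum s
  length-Efin []      x = refl
  length-Efin (a ∷ s) x = trans (length-++ (replicate a x))
    (cong₂ _+_ (length-replicate a) (length-Efin s (bar m n x)))

  Einf-≥ : ∀ y {x} → m ≤ x → x ≤ n → ∀ p → m ≤ Einf m n y x p
  Einf-≥ y m≤x x≤n p with isEven (runIdx y p)
  ... | true  = m≤x
  ... | false = bar-≥ x≤n

  module _ (1≤m : 1 ≤ m) where

    runValue-runIdxFuel : ∀ {x} → x ≤ m + n → ∀ s {y} → (∀ i → m ≤ y i) → Prefix s y →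
      ∀ f q → q < f → q < sum (s ++ [ m ]) →
      runValue x (runIdxFuel f y 0 q) ≡ nth (Efin m n (s ++ [ m ]) x) q
    runValue-runIdxFuel {x} x≤ [] {y} y≥m _ (suc f) q _ q<m+0 =
      trans (cong (runValue x) (runIdxFuel-< f y 0 q (<-≤-trans q<m (y≥m 0))))
            (sym (nth-++-replicate-< m x [] q q<m))
      where
      q<m : q < m
      q<m = subst (q <_) (+-identityʳ m) q<m+0
    runValue-runIdxFuel {x} x≤ (a ∷ s) {y} y≥m s≼y (suc f) q q<1+f q<sum with s≼y 0 (s≤s z≤n)
    ... | refl with q <? y 0
    ...   | yes q<a = trans (cong (runValue x) (runIdxFuel-< f y 0 q q<a))
                            (sym (nth-++-replicate-< a x _ q q<a))
    ...   | no  q≮a = begin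
      runValue x (runIdxFuel (suc f) y 0 q)         ≡⟨ cong (runValue x) (runIdxFuel-≥ f y 0 q a≤q) ⟩
      runValue x (runIdxFuel f y 1 (q ∸ a))         ≡⟨ cong (runValue x) (runIdxFuel-shift f y 0 (q ∸ a)) ⟩
      runValue x (suc (runIdxFuel f (y ∘ suc) 0 (q ∸ a)))
        ≡⟨ runValue-suc x≤ (runIdxFuel f (y ∘ suc) 0 (q ∸ a)) ⟩
      runValue (bar m n x) (runIdxFuel f (y ∘ suc) 0 (q ∸ a))
        ≡⟨ runValue-runIdxFuel (bar-≤ x) s (y≥m ∘ suc) (λ p p< → s≼y (suc p) (s≤s p<))
                               f (q ∸ a) q∸a<f q∸a<sum ⟩
      nth (Efin m n (s ++ [ m ]) (bar m n x)) (q ∸ a) ≡⟨ sym (nth-++-replicate-≥ a x (Efin m n (s ++ [ m ]) (bar m n x)) q a≤q) ⟩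
      nth (Efin m n (a ∷ s ++ [ m ]) x) q           ∎
      where
      a≤q : a ≤ q
      a≤q = ≮⇒≥ q≮a
      q∸a<f : q ∸ a < f
      q∸a<f = <-≤-trans (∸-monoˡ-< q<1+f a≤q) (∸-monoʳ-≤ (suc f) (≤-trans 1≤m (y≥m 0)))
      q∸a<sum : q ∸ a < sum (s ++ [ m ])
      q∸a<sum = subst (q ∸ a <_) (m+n∸m≡n a _) (∸-monoˡ-< q<sum a≤q)

    Einf-prefix : ∀ {x} → x ≤ m + n → ∀ s {y} → (∀ i → m ≤ y i) → Prefix s y →
      Prefix (Efin m n (s ++ [ m ]) x) (Einf m n y x)
    Einf-prefix {x} x≤ s y≥m s≼y p p<len =
      runValue-runIdxFuel x≤ s y≥m s≼y (suc p) p ≤-refl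
        (subst (p <_) (length-Efin (s ++ [ m ]) x) p<len)

    EinfW-prefix : ∀ {k} (t : Vec ℕ k) → All (λ x → m ≤ x × x ≤ n) t →
      ∀ s {y} → (∀ i → m ≤ y i) → Prefix s y → Prefix (sChain m n s (toList t)) (EinfW m n y t)
    EinfW-prefix Vec.[]      All.[]                     s y≥m s≼y = s≼y
    EinfW-prefix (x Vec.∷ t) ((m≤x , x≤n) All.∷ t∈[m,n]) s {y} y≥m s≼y =
      EinfW-prefix t t∈[m,n] (Efin m n (s ++ [ m ]) x) (Einf-≥ y m≤x x≤n)
        (Einf-prefix (≤-trans x≤n (m≤n+m n m)) s y≥m s≼y)

  toList∈choices : ∀ {k} (t : Vec ℕ k) → All (λ x → x ≡ m ⊎ x ≡ n) t → toList t ∈ choices m n k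
  toList∈choices Vec.[]               All.[]          = here refl
  toList∈choices {suc k} (x Vec.∷ t) (x∈mn All.∷ t∈mn) = extend x∈mn (choices m n k) (toList∈choices t t∈mn)
    where
    extend : x ≡ m ⊎ x ≡ n → ∀ cs → toList t ∈ cs →
      x ∷ toList t ∈ concatMap (λ c → (m ∷ c) ∷ (n ∷ c) ∷ []) cs
    extend (inj₁ refl) (c ∷ cs) (here refl) = here refl
    extend (inj₂ refl) (c ∷ cs) (here refl) = there (here refl)
    extend x∈mn        (c ∷ cs) (there c∈) = there (there (extend x∈mn cs c∈))

∈⇒minList≤ : ∀ {x xs} → x ∈ xs → minList xs ≤ x
∈⇒minList≤ {xs = a ∷ []}    (here refl) = ≤-refl
∈⇒minList≤ {xs = a ∷ b ∷ _} (here refl) = m⊓n≤m a _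
∈⇒minList≤ {xs = a ∷ b ∷ _} (there x∈) = ≤-trans (m⊓n≤n a _) (∈⇒minList≤ x∈)

D≤length-sChain : ∀ m n {k} (t : Vec ℕ k) → All (λ x → x ≡ m ⊎ x ≡ n) t →
  D m n k ≤ length (sChain m n [] (toList t))
D≤length-sChain m n t t∈mn =
  ∈⇒minList≤ (∈-map⁺ (λ c → length (sChain m n [] c)) (toList∈choices m n t t∈mn))

lemma3p4 : (m n : ℕ) → 1 ≤ m → m < n → ¬ (2 ∣ m + n) →
    (k : ℕ) → 1 ≤ k → (t : Vec ℕ k) → All (λ x → x ≡ m ⊎ x ≡ n) t →
    (y y′ : ℕ → ℕ) → (∀ i → y i ≡ m ⊎ y i ≡ n) → (∀ i → y′ i ≡ m ⊎ y′ i ≡ n) →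
    ∀ p → p < D m n k → EinfW m n y t p ≡ EinfW m n y′ t p
lemma3p4 m n 1≤m m<n _ k _ t t∈mn y y′ y∈mn y′∈mn p p<D =
  trans (starts-with y y∈mn p p<len) (sym (starts-with y′ y′∈mn p p<len))
  where
  ≥m : ∀ {x} → x ≡ m ⊎ x ≡ n → m ≤ x
  ≥m (inj₁ refl) = ≤-refl
  ≥m (inj₂ refl) = <⇒≤ m<n

  ∈[m,n] : ∀ {x} → x ≡ m ⊎ x ≡ n → m ≤ x × x ≤ n
  ∈[m,n] (inj₁ refl) = ≤-refl , <⇒≤ m<n
  ∈[m,n] (inj₂ refl) = <⇒≤ m<n , ≤-refl

  starts-with : ∀ z → (∀ i → z i ≡ m ⊎ z i ≡ n) → Prefix (sChain m n [] (toList t)) (EinfW m n z t)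
  starts-with z z∈mn = EinfW-prefix m n 1≤m t (All.map ∈[m,n] t∈mn) [] (≥m ∘ z∈mn) (λ _ ())

  p<len : p < length (sChain m n [] (toList t))
  p<len = <-≤-trans p<D (D≤length-sChain m n t t∈mn)
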